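{- The 2-endofunctor $\mathrm{Inv}$ preserves $\ast$-autonomous categories: if $(\mathcal A,\otimes,1,\bot)$ is $\ast$-autonomous, then $\mathrm{Inv}(\mathcal A)$ with its induced symmetric monoidal structure is $\ast$-autonomous (in particular it is symmetric monoidal closed, with internal hom $(A,s)\multimap'(B,t)=(A\multimap B,(s_k\multimap t_k)_{k\in\mathbb Z})$, and $(\bot,(id_\bot)_{k\in\mathbb Z})$ is a dualizing object).
   Context: A symmetric monoidal closed category is a symmetric monoidal category $(\mathcal A,\otimes,1)$ such that each $-\otimes X$ has a right adjoint $X\multimap -$, giving a natural isomorphism $\Psi:\mathcal A[-\otimes-,-]\Rightarrow\mathcal A[-,-\multimap-]$; $\mathrm{eval}_{A,B}=\Psi^{ -1}(id_{A\multimap B}):(A\multimap B)\otimes A\to B$. It is $\ast$-autonomous with dualizing object $\bot$ if for every object $A$, $\Psi_{A,A\multimap\bot,\bot}(\mathrm{eval}_{A,\bot}\circ\gamma_{A,A\multimap\bot}):A\to(A\multimap\bot)\multimap\bot$ is an isomorphism ($\gamma$ the symmetry). For a category $\mathcal A$, $\mathrm{Inv}(\mathcal A)$ has objects $(A,s)$ with $s=(s_k)_{k\in\mathbb Z}$ automorphisms of $A$ satisfying $s_k\circ s_k=id_A$, and morphisms $(A,s)\to(B,t)$ the arrows $f:A\to B$ of $\mathcal A$ with $t_k\circ f\circ s_k=f$ for all $k$. Its symmetric monoidal structure is $(A,s)\otimes'(B,t)=(A\otimes B,(s_k\otimes t_k)_k)$, $f\otimes'g=f\otimes g$, unit $(1,(id_1)_k)$,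 structural isomorphisms those of $\mathcal A$. -}

module Defs where

open import Level using (Level; _⊔_; suc)
open import Data.Integer using (ℤ)
open import Data.Product using (Σ; _,_; proj₁; proj₂)
open import Relation.Binary using (IsEquivalence; Setoid)

record Category (o ℓ e : Level) : Set (suc (o ⊔ ℓ ⊔ e)) where
  infixr 9 _∘_
  infix  4 _≈_
  field
    Obj  : Set o
    _⇒_  : Obj → Obj → Set ℓ
    _≈_  : ∀ {A B} → A ⇒ B → A ⇒ B → Set e
    equiv : ∀ {A B} → IsEquivalence (_≈_ {A} {B})
    id   : ∀ {A} → A ⇒ A
    _∘_  : ∀ {A B C} → B ⇒ C → A ⇒ B → A ⇒ C
    identityˡ : ∀ {A B} {f : A ⇒ B} → id ∘ f ≈ f
    identityʳ : ∀ {A B} {f : A ⇒ B} → f ∘ id ≈ f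
    assoc : ∀ {A B C D} {f : A ⇒ B} {g : B ⇒ C} {h : C ⇒ D} →
            (h ∘ g) ∘ f ≈ h ∘ (g ∘ f)
    ∘-resp-≈ : ∀ {A B C} {f h : B ⇒ C} {g i : A ⇒ B} →
               f ≈ h → g ≈ i → f ∘ g ≈ h ∘ i

  hom-setoid : ∀ {A B} → Setoid ℓ e
  hom-setoid {A} {B} = record { Carrier = A ⇒ B ; _≈_ = _≈_ ; isEquivalence = equiv }

  module Equiv {A B : Obj} = IsEquivalence (equiv {A} {B})

  record IsIso {A B : Obj} (f : A ⇒ B) : Set (ℓ ⊔ e) where
    field
      inv : B ⇒ A
      isoˡ : inv ∘ f ≈ id
      isoʳ : f ∘ inv ≈ id

record SymmetricMonoidal {o ℓ e : Level} (C : Category o ℓ e) : Set (o ⊔ ℓ ⊔ e) where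
  open Category C
  infixr 10 _⊗₀_ _⊗₁_
  field
    _⊗₀_ : Obj → Obj → Obj
    _⊗₁_ : ∀ {A B X Y} → A ⇒ B → X ⇒ Y → (A ⊗₀ X) ⇒ (B ⊗₀ Y)
    ⊗-identity : ∀ {A X} → id {A} ⊗₁ id {X} ≈ id
    ⊗-homomorphism : ∀ {A B C' X Y Z} {f : A ⇒ B} {g : B ⇒ C'} {h : X ⇒ Y} {i : Y ⇒ Z} →
                     (g ∘ f) ⊗₁ (i ∘ h) ≈ (g ⊗₁ i) ∘ (f ⊗₁ h)
    ⊗-resp-≈ : ∀ {A B X Y} {f f' : A ⇒ B} {g g' : X ⇒ Y} →
               f ≈ f' → g ≈ g' → f ⊗₁ g ≈ f' ⊗₁ g'
    unit : Obj
    α⇒ : ∀ {A B C'} → ((A ⊗₀ B) ⊗₀ C') ⇒ (A ⊗₀ (B ⊗₀ C'))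
    α⇐ : ∀ {A B C'} → (A ⊗₀ (B ⊗₀ C')) ⇒ ((A ⊗₀ B) ⊗₀ C')
    λ⇒ : ∀ {A} → (unit ⊗₀ A) ⇒ A
    λ⇐ : ∀ {A} → A ⇒ (unit ⊗₀ A)
    ρ⇒ : ∀ {A} → (A ⊗₀ unit) ⇒ A
    ρ⇐ : ∀ {A} → A ⇒ (A ⊗₀ unit)
    γ  : ∀ {A B} → (A ⊗₀ B) ⇒ (B ⊗₀ A)
    α-isoˡ : ∀ {A B C'} → α⇐ {A} {B} {C'} ∘ α⇒ ≈ id
    α-isoʳ : ∀ {A B C'} → α⇒ {A} {B} {C'} ∘ α⇐ ≈ id
    λ-isoˡ : ∀ {A} → λ⇐ {A} ∘ λ⇒ ≈ id
    λ-isoʳ : ∀ {A} → λ⇒ {A} ∘ λ⇐ ≈ id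
    ρ-isoˡ : ∀ {A} → ρ⇐ {A} ∘ ρ⇒ ≈ id
    ρ-isoʳ : ∀ {A} → ρ⇒ {A} ∘ ρ⇐ ≈ id
    γ-inv : ∀ {A B} → γ {B} {A} ∘ γ {A} {B} ≈ id
    α⇒-natural : ∀ {A A' B B' C' C''} {f : A ⇒ A'} {g : B ⇒ B'} {h : C' ⇒ C''} →
                 α⇒ ∘ ((f ⊗₁ g) ⊗₁ h) ≈ (f ⊗₁ (g ⊗₁ h)) ∘ α⇒
    α⇐-natural : ∀ {A A' B B' C' C''} {f : A ⇒ A'} {g : B ⇒ B'} {h : C' ⇒ C''} →
                 α⇐ ∘ (f ⊗₁ (g ⊗₁ h)) ≈ ((f ⊗₁ g) ⊗₁ h) ∘ α⇐
    λ⇒-natural : ∀ {A B} {f : A ⇒ B} → λ⇒ ∘ (id ⊗₁ f) ≈ f ∘ λ⇒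
    λ⇐-natural : ∀ {A B} {f : A ⇒ B} → λ⇐ ∘ f ≈ (id ⊗₁ f) ∘ λ⇐
    ρ⇒-natural : ∀ {A B} {f : A ⇒ B} → ρ⇒ ∘ (f ⊗₁ id) ≈ f ∘ ρ⇒
    ρ⇐-natural : ∀ {A B} {f : A ⇒ B} → ρ⇐ ∘ f ≈ (f ⊗₁ id) ∘ ρ⇐
    γ-natural  : ∀ {A A' B B'} {f : A ⇒ A'} {g : B ⇒ B'} →
                 γ ∘ (f ⊗₁ g) ≈ (g ⊗₁ f) ∘ γ
    pentagon : ∀ {A B C' D} →
               (id {A} ⊗₁ α⇒ {B} {C'} {D}) ∘ (α⇒ ∘ (α⇒ ⊗₁ id)) ≈ α⇒ ∘ α⇒
    triangle : ∀ {A B} → (id {A} ⊗₁ λ⇒ {B}) ∘ α⇒ ≈ ρ⇒ ⊗₁ id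
    hexagon  : ∀ {A B C'} →
               (id {B} ⊗₁ γ {A} {C'}) ∘ (α⇒ ∘ (γ ⊗₁ id)) ≈ α⇒ ∘ (γ ∘ α⇒)

-- Closed structure: a natural bijection
--   Ψ : C[X ⊗ A, B] ≅ C[X, A ⊸ B]
-- (naturality in X; the functorial action of ⊸ is then the induced one,
--  see _⊸₁_ below, for which Ψ is automatically natural in A and B)

record Closed {o ℓ e : Level} {C : Category o ℓ e} (M : SymmetricMonoidal C)
       : Set (o ⊔ ℓ ⊔ e) where
  open Category C
  open SymmetricMonoidal M
  infixr 5 _⊸_
  field
    _⊸_ : Obj → Obj → Obj
    Ψ   : ∀ {X A B} → (X ⊗₀ A) ⇒ B → X ⇒ (A ⊸ B)
    Ψ⁻¹ : ∀ {X A B} → X ⇒ (A ⊸ B) → (X ⊗₀ A) ⇒ B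
    Ψ-resp-≈   : ∀ {X A B} {f g : (X ⊗₀ A) ⇒ B} → f ≈ g → Ψ f ≈ Ψ g
    Ψ⁻¹-resp-≈ : ∀ {X A B} {f g : X ⇒ (A ⊸ B)} → f ≈ g → Ψ⁻¹ f ≈ Ψ⁻¹ g
    Ψ⁻¹∘Ψ : ∀ {X A B} {f : (X ⊗₀ A) ⇒ B} → Ψ⁻¹ (Ψ f) ≈ f
    Ψ∘Ψ⁻¹ : ∀ {X A B} {f : X ⇒ (A ⊸ B)} → Ψ (Ψ⁻¹ f) ≈ f
    Ψ-natural : ∀ {X Y A B} {f : (X ⊗₀ A) ⇒ B} {g : Y ⇒ X} →
                Ψ (f ∘ (g ⊗₁ id)) ≈ Ψ f ∘ g

  eval : ∀ {A B} → ((A ⊸ B) ⊗₀ A) ⇒ B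
  eval = Ψ⁻¹ id

  _⊸₁_ : ∀ {A A' B B'} → A' ⇒ A → B ⇒ B' → (A ⊸ B) ⇒ (A' ⊸ B')
  f ⊸₁ g = Ψ (g ∘ (eval ∘ (id ⊗₁ f)))

record StarAutonomous {o ℓ e : Level} {C : Category o ℓ e} (M : SymmetricMonoidal C)
       : Set (o ⊔ ℓ ⊔ e) where
  open Category C
  open SymmetricMonoidal M
  field
    closed : Closed M
  open Closed closed
  field
    ⊥ : Obj
  dual-map : (A : Obj) → A ⇒ ((A ⊸ ⊥) ⊸ ⊥)
  dual-map A = Ψ (eval {A} {⊥} ∘ γ {A} {A ⊸ ⊥})
  field
    dualizing : (A : Obj) → IsIso (dual-map A)

module _ {o ℓ e : Level} (C : Category o ℓ e) where
  open Category C

  record InvObj : Set (o ⊔ ℓ ⊔ e) where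
    constructor invObj
    field
      obj   : Obj
      s     : ℤ → obj ⇒ obj
      invol : ∀ k → s k ∘ s k ≈ id

  record InvHom (X Y : InvObj) : Set (ℓ ⊔ e) where
    constructor invHom
    private
      module X = InvObj X
      module Y = InvObj Y
    field
      arr   : X.obj ⇒ Y.obj
      equivariant : ∀ k → Y.s k ∘ (arr ∘ X.s k) ≈ arr

open InvObj public
open InvHom public

module InvLemmas {o ℓ e : Level} (C : Category o ℓ e) where
  open Category C

  infixr 4 _⟫_
  _⟫_ : ∀ {A B} {f g h : A ⇒ B} → f ≈ g → g ≈ h → f ≈ h
  _⟫_ = Equiv.trans

  twist : ∀ {A B} {φ : A ⇒ B} {S : A ⇒ A} {T : B ⇒ B} →
          φ ∘ S ≈ T ∘ φ → T ∘ T ≈ id → T ∘ (φ ∘ S) ≈ φ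
  twist nat inv =
    ∘-resp-≈ Equiv.refl nat ⟫ Equiv.sym assoc ⟫
    ∘-resp-≈ inv Equiv.refl ⟫ identityˡ

  comp-equiv : ∀ {X Y Z : InvObj C} (g : InvHom C Y Z) (f : InvHom C X Y) k →
     s Z k ∘ ((arr g ∘ arr f) ∘ s X k) ≈ arr g ∘ arr f
  comp-equiv {X} {Y} {Z} g f k =
    ∘-resp-≈ Equiv.refl assoc ⟫
    ∘-resp-≈ Equiv.refl (∘-resp-≈ Equiv.refl (Equiv.sym identityˡ)) ⟫
    ∘-resp-≈ Equiv.refl (∘-resp-≈ Equiv.refl
      (∘-resp-≈ (Equiv.sym (invol Y k)) Equiv.refl)) ⟫
    ∘-resp-≈ Equiv.refl (∘-resp-≈ Equiv.refl assoc) ⟫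
    ∘-resp-≈ Equiv.refl (Equiv.sym assoc) ⟫
    Equiv.sym assoc ⟫
    ∘-resp-≈ (equivariant g k) (equivariant f k)

Inv : {o ℓ e : Level} → Category o ℓ e → Category (o ⊔ ℓ ⊔ e) (ℓ ⊔ e) e
Inv C = record
  { Obj = InvObj C
  ; _⇒_ = InvHom C
  ; _≈_ = λ f g → arr f ≈ arr g
  ; equiv = record { refl = Equiv.refl ; sym = Equiv.sym ; trans = Equiv.trans }
  ; id = λ {X} → invHom id (λ k → Equiv.trans (∘-resp-≈ Equiv.refl identityˡ) (invol X k))
  ; _∘_ = λ g f → invHom (arr g ∘ arr f) (comp-equiv g f)
  ; identityˡ = identityˡ
  ; identityʳ = identityʳ
  ; assoc = assoc
  ; ∘-resp-≈ = ∘-resp-≈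
  }
  where
    open Category C
    open InvLemmas C

InvSM : {o ℓ e : Level} {C : Category o ℓ e} → SymmetricMonoidal C →
        SymmetricMonoidal (Inv C)
InvSM {C = C} M = record
  { _⊗₀_ = _⊗'_
  ; _⊗₁_ = λ f g → invHom (arr f ⊗₁ arr g) (tens-equiv f g)
  ; ⊗-identity = ⊗-identity
  ; ⊗-homomorphism = ⊗-homomorphism
  ; ⊗-resp-≈ = ⊗-resp-≈
  ; unit = unit'
  ; α⇒ = mkStr α⇒ (λ k → α⇒-natural)
  ; α⇐ = mkStr α⇐ (λ k → α⇐-natural)
  ; λ⇒ = mkStr λ⇒ (λ k → λ⇒-natural)
  ; λ⇐ = mkStr λ⇐ (λ k → λ⇐-natural)
  ; ρ⇒ = mkStr ρ⇒ (λ k → ρ⇒-natural)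
  ; ρ⇐ = mkStr ρ⇐ (λ k → ρ⇐-natural)
  ; γ  = mkStr γ (λ k → γ-natural)
  ; α-isoˡ = α-isoˡ
  ; α-isoʳ = α-isoʳ
  ; λ-isoˡ = λ-isoˡ
  ; λ-isoʳ = λ-isoʳ
  ; ρ-isoˡ = ρ-isoˡ
  ; ρ-isoʳ = ρ-isoʳ
  ; γ-inv = γ-inv
  ; α⇒-natural = α⇒-natural
  ; α⇐-natural = α⇐-natural
  ; λ⇒-natural = λ⇒-natural
  ; λ⇐-natural = λ⇐-natural
  ; ρ⇒-natural = ρ⇒-natural
  ; ρ⇐-natural = ρ⇐-natural
  ; γ-natural = γ-natural
  ; pentagon = pentagon
  ; triangle = triangle
  ; hexagon = hexagon
  }
  where
    open Category C
    open SymmetricMonoidal M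
    open InvLemmas C
  
    _⊗'_ : InvObj C → InvObj C → InvObj C
    X ⊗' Y = invObj (obj X ⊗₀ obj Y) (λ k → s X k ⊗₁ s Y k)
      (λ k → Equiv.trans (Equiv.sym ⊗-homomorphism)
               (Equiv.trans (⊗-resp-≈ (invol X k) (invol Y k)) ⊗-identity))

    mkStr : ∀ {X Y : InvObj C} (φ : obj X ⇒ obj Y) →
            (∀ k → φ ∘ s X k ≈ s Y k ∘ φ) → InvHom C X Y
    mkStr {Y = Y} φ nat = invHom φ (λ k → twist (nat k) (invol Y k))

    unit' : InvObj C
    unit' = invObj unit (λ _ → id) (λ _ → identityˡ)

    tens-equiv : ∀ {X X' Y Y'} (f : InvHom C X X') (g : InvHom C Y Y') k →
      (s X' k ⊗₁ s Y' k) ∘ ((arr f ⊗₁ arr g) ∘ (s X k ⊗₁ s Y k)) ≈ arr f ⊗₁ arr g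
    tens-equiv f g k = Equiv.trans
      (∘-resp-≈ Equiv.refl (Equiv.sym ⊗-homomorphism))
      (Equiv.trans (Equiv.sym ⊗-homomorphism)
        (⊗-resp-≈ (equivariant f k) (equivariant g k)))

open import Relation.Binary.PropositionalEquality using (_≡_; subst)
open import Data.Product using (_×_)

module _ {o ℓ e : Level} {C : Category o ℓ e} {M : SymmetricMonoidal C} where
  open Category C

  HasStandardDescription : StarAutonomous M → StarAutonomous (InvSM M) → Set (o ⊔ ℓ ⊔ e)
  HasStandardDescription S S' =
    (∀ (X Y : InvObj C) →
       Σ (obj (X ⊸' Y) ≡ (obj X ⊸ obj Y)) λ p →
         ∀ k → subst (λ Z → Z ⇒ Z) p (s (X ⊸' Y) k) ≈ (s X k ⊸₁ s Y k))
    ×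
    (Σ (obj ⊥' ≡ ⊥) λ p → ∀ k → subst (λ Z → Z ⇒ Z) p (s ⊥' k) ≈ id)
    where
      open StarAutonomous S using (⊥; closed)
      open Closed closed using (_⊸_; _⊸₁_)
      open StarAutonomous S' using () renaming (⊥ to ⊥'; closed to closed')
      open Closed closed' using () renaming (_⊸_ to _⊸'_)

-- An arrow of Inv(A) is just an arrow of A commuting with the chosen
-- involutions, so the closed structure of A lifts as soon as the
-- transpose Ψ and its inverse preserve this commutation. Both follow from
-- one identity: transposing (s ⊸ t) ∘ g ∘ r gives t ∘ Ψ⁻¹ g ∘ (r ⊗ s).
-- The canonical map into the double dual of (A, s) is then the canonical
-- map of A, which is invertible in Inv(A) because the inverse of an
-- equivariant isomorphism is again equivariant.
module Submission where

open import Defs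
open import Level using (Level)
open import Data.Product using (Σ; _,_)
open import Relation.Binary.PropositionalEquality using (refl)
import Relation.Binary.Reasoning.Setoid as SetoidReasoning

module HomReasoning {o ℓ e : Level} (C : Category o ℓ e) where
  open Category C

  module _ {A B : Obj} where
    open SetoidReasoning (hom-setoid {A} {B}) public

  infixr 4 _⟩∘⟨_ refl⟩∘⟨_
  infixl 5 _⟩∘⟨refl

  _⟩∘⟨_ : ∀ {A B D} {f h : B ⇒ D} {g i : A ⇒ B} → f ≈ h → g ≈ i → f ∘ g ≈ h ∘ i
  _⟩∘⟨_ = ∘-resp-≈

  refl⟩∘⟨_ : ∀ {A B D} {f : B ⇒ D} {g i : A ⇒ B} → g ≈ i → f ∘ g ≈ f ∘ i
  refl⟩∘⟨ p = Equiv.refl ⟩∘⟨ p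

  _⟩∘⟨refl : ∀ {A B D} {f h : B ⇒ D} {g : A ⇒ B} → f ≈ h → f ∘ g ≈ h ∘ g
  p ⟩∘⟨refl = p ⟩∘⟨ Equiv.refl

module InvIsomorphisms {o ℓ e : Level} (C : Category o ℓ e) where
  open Category C
  open HomReasoning C
  open InvLemmas C using (twist)

  equivariant⇒commutes : ∀ {X Y : InvObj C} (f : InvHom C X Y) k →
                         arr f ∘ s X k ≈ s Y k ∘ arr f
  equivariant⇒commutes {X} {Y} f k = begin
    arr f ∘ s X k                         ≈⟨ Equiv.sym identityˡ ⟩
    id ∘ (arr f ∘ s X k)                  ≈⟨ Equiv.sym (invol Y k) ⟩∘⟨refl ⟩
    (s Y k ∘ s Y k) ∘ (arr f ∘ s X k)     ≈⟨ assoc ⟩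
    s Y k ∘ (s Y k ∘ (arr f ∘ s X k))     ≈⟨ refl⟩∘⟨ equivariant f k ⟩
    s Y k ∘ arr f                         ∎

  inverse-commutes : ∀ {A B} {f : A ⇒ B} {g : B ⇒ A} {S : A ⇒ A} {T : B ⇒ B} →
                     f ∘ S ≈ T ∘ f → g ∘ f ≈ id → f ∘ g ≈ id → g ∘ T ≈ S ∘ g
  inverse-commutes {f = f} {g} {S} {T} commutes gf≈id fg≈id = begin
    g ∘ T                 ≈⟨ Equiv.sym identityʳ ⟩
    (g ∘ T) ∘ id          ≈⟨ refl⟩∘⟨ Equiv.sym fg≈id ⟩
    (g ∘ T) ∘ (f ∘ g)     ≈⟨ assoc ⟩
    g ∘ (T ∘ (f ∘ g))     ≈⟨ refl⟩∘⟨ Equiv.sym assoc ⟩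
    g ∘ ((T ∘ f) ∘ g)     ≈⟨ refl⟩∘⟨ Equiv.sym commutes ⟩∘⟨refl ⟩
    g ∘ ((f ∘ S) ∘ g)     ≈⟨ Equiv.sym assoc ⟩
    (g ∘ (f ∘ S)) ∘ g     ≈⟨ Equiv.sym assoc ⟩∘⟨refl ⟩
    ((g ∘ f) ∘ S) ∘ g     ≈⟨ (gf≈id ⟩∘⟨refl) ⟩∘⟨refl ⟩
    (id ∘ S) ∘ g          ≈⟨ identityˡ ⟩∘⟨refl ⟩
    S ∘ g                 ∎

  Inv-reflects-iso : ∀ {X Y : InvObj C} (f : InvHom C X Y) →
                     IsIso (arr f) → Category.IsIso (Inv C) f
  Inv-reflects-iso {X} {Y} f iso = record
    { inv  = invHom inv λ k →
               twist (inverse-commutes (equivariant⇒commutes f k) isoˡ isoʳ) (invol X k)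
    ; isoˡ = isoˡ
    ; isoʳ = isoʳ
    }
    where open IsIso iso

module MonoidalLemmas {o ℓ e : Level} {C : Category o ℓ e} (M : SymmetricMonoidal C) where
  open Category C
  open SymmetricMonoidal M

  serialize₁₂ : ∀ {A B X Y} {f : A ⇒ B} {g : X ⇒ Y} → f ⊗₁ g ≈ (f ⊗₁ id) ∘ (id ⊗₁ g)
  serialize₁₂ = Equiv.trans (⊗-resp-≈ (Equiv.sym identityʳ) (Equiv.sym identityˡ))
                            ⊗-homomorphism

  serialize₂₁ : ∀ {A B X Y} {f : A ⇒ B} {g : X ⇒ Y} → f ⊗₁ g ≈ (id ⊗₁ g) ∘ (f ⊗₁ id)
  serialize₂₁ = Equiv.trans (⊗-resp-≈ (Equiv.sym identityˡ) (Equiv.sym identityʳ))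
                            ⊗-homomorphism

module ClosedLemmas {o ℓ e : Level} {C : Category o ℓ e} {M : SymmetricMonoidal C}
                    (K : Closed M) where
  open Category C
  open SymmetricMonoidal M
  open Closed K
  open HomReasoning C
  open MonoidalLemmas M

  Ψ⁻¹-natural : ∀ {X Y A B} {g : X ⇒ (A ⊸ B)} {h : Y ⇒ X} →
                Ψ⁻¹ (g ∘ h) ≈ Ψ⁻¹ g ∘ (h ⊗₁ id)
  Ψ⁻¹-natural {g = g} {h} = begin
    Ψ⁻¹ (g ∘ h)                         ≈⟨ Ψ⁻¹-resp-≈ (Equiv.sym Ψ∘Ψ⁻¹ ⟩∘⟨refl) ⟩
    Ψ⁻¹ (Ψ (Ψ⁻¹ g) ∘ h)                 ≈⟨ Ψ⁻¹-resp-≈ (Equiv.sym Ψ-natural) ⟩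
    Ψ⁻¹ (Ψ (Ψ⁻¹ g ∘ (h ⊗₁ id)))         ≈⟨ Ψ⁻¹∘Ψ ⟩
    Ψ⁻¹ g ∘ (h ⊗₁ id)                   ∎

  Ψ⁻¹-injective : ∀ {X A B} {f g : X ⇒ (A ⊸ B)} → Ψ⁻¹ f ≈ Ψ⁻¹ g → f ≈ g
  Ψ⁻¹-injective p = Equiv.trans (Equiv.sym Ψ∘Ψ⁻¹) (Equiv.trans (Ψ-resp-≈ p) Ψ∘Ψ⁻¹)

  Ψ⁻¹≈eval∘ : ∀ {X A B} {h : X ⇒ (A ⊸ B)} → Ψ⁻¹ h ≈ eval ∘ (h ⊗₁ id)
  Ψ⁻¹≈eval∘ = Equiv.trans (Ψ⁻¹-resp-≈ (Equiv.sym identityˡ)) Ψ⁻¹-natural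

  Ψ⁻¹-⊸₁ : ∀ {X A A' B B'} {a : A' ⇒ A} {b : B ⇒ B'} {h : X ⇒ (A ⊸ B)} →
           Ψ⁻¹ ((a ⊸₁ b) ∘ h) ≈ b ∘ (Ψ⁻¹ h ∘ (id ⊗₁ a))
  Ψ⁻¹-⊸₁ {a = a} {b} {h} = begin
    Ψ⁻¹ ((a ⊸₁ b) ∘ h)                          ≈⟨ Ψ⁻¹-natural ⟩
    Ψ⁻¹ (a ⊸₁ b) ∘ (h ⊗₁ id)                    ≈⟨ Ψ⁻¹∘Ψ ⟩∘⟨refl ⟩
    (b ∘ (eval ∘ (id ⊗₁ a))) ∘ (h ⊗₁ id)        ≈⟨ assoc ⟩
    b ∘ ((eval ∘ (id ⊗₁ a)) ∘ (h ⊗₁ id))        ≈⟨ refl⟩∘⟨ assoc ⟩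
    b ∘ (eval ∘ ((id ⊗₁ a) ∘ (h ⊗₁ id)))        ≈⟨ refl⟩∘⟨ refl⟩∘⟨ interchange ⟩
    b ∘ (eval ∘ ((h ⊗₁ id) ∘ (id ⊗₁ a)))        ≈⟨ refl⟩∘⟨ Equiv.sym assoc ⟩
    b ∘ ((eval ∘ (h ⊗₁ id)) ∘ (id ⊗₁ a))        ≈⟨ refl⟩∘⟨ Equiv.sym Ψ⁻¹≈eval∘ ⟩∘⟨refl ⟩
    b ∘ (Ψ⁻¹ h ∘ (id ⊗₁ a))                     ∎
    where
      interchange : (id ⊗₁ a) ∘ (h ⊗₁ id) ≈ (h ⊗₁ id) ∘ (id ⊗₁ a)
      interchange = Equiv.trans (Equiv.sym serialize₂₁) serialize₁₂

  Ψ⁻¹-conjugate : ∀ {X A B} {r : X ⇒ X} {s : A ⇒ A} {t : B ⇒ B} {g : X ⇒ (A ⊸ B)} →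
                  Ψ⁻¹ ((s ⊸₁ t) ∘ (g ∘ r)) ≈ t ∘ (Ψ⁻¹ g ∘ (r ⊗₁ s))
  Ψ⁻¹-conjugate {r = r} {s} {t} {g} = begin
    Ψ⁻¹ ((s ⊸₁ t) ∘ (g ∘ r))                ≈⟨ Ψ⁻¹-⊸₁ ⟩
    t ∘ (Ψ⁻¹ (g ∘ r) ∘ (id ⊗₁ s))           ≈⟨ refl⟩∘⟨ Ψ⁻¹-natural ⟩∘⟨refl ⟩
    t ∘ ((Ψ⁻¹ g ∘ (r ⊗₁ id)) ∘ (id ⊗₁ s))   ≈⟨ refl⟩∘⟨ assoc ⟩
    t ∘ (Ψ⁻¹ g ∘ ((r ⊗₁ id) ∘ (id ⊗₁ s)))   ≈⟨ refl⟩∘⟨ refl⟩∘⟨ Equiv.sym serialize₁₂ ⟩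
    t ∘ (Ψ⁻¹ g ∘ (r ⊗₁ s))                  ∎

  Ψ-preserves-fixed : ∀ {X A B} {r : X ⇒ X} {s : A ⇒ A} {t : B ⇒ B} {f : (X ⊗₀ A) ⇒ B} →
                      t ∘ (f ∘ (r ⊗₁ s)) ≈ f → (s ⊸₁ t) ∘ (Ψ f ∘ r) ≈ Ψ f
  Ψ-preserves-fixed {r = r} {s} {t} {f} fixed = Ψ⁻¹-injective (begin
    Ψ⁻¹ ((s ⊸₁ t) ∘ (Ψ f ∘ r))      ≈⟨ Ψ⁻¹-conjugate ⟩
    t ∘ (Ψ⁻¹ (Ψ f) ∘ (r ⊗₁ s))      ≈⟨ refl⟩∘⟨ Ψ⁻¹∘Ψ ⟩∘⟨refl ⟩
    t ∘ (f ∘ (r ⊗₁ s))              ≈⟨ fixed ⟩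
    f                               ≈⟨ Equiv.sym Ψ⁻¹∘Ψ ⟩
    Ψ⁻¹ (Ψ f)                       ∎)

  Ψ⁻¹-preserves-fixed : ∀ {X A B} {r : X ⇒ X} {s : A ⇒ A} {t : B ⇒ B} {g : X ⇒ (A ⊸ B)} →
                        (s ⊸₁ t) ∘ (g ∘ r) ≈ g → t ∘ (Ψ⁻¹ g ∘ (r ⊗₁ s)) ≈ Ψ⁻¹ g
  Ψ⁻¹-preserves-fixed fixed = Equiv.trans (Equiv.sym Ψ⁻¹-conjugate) (Ψ⁻¹-resp-≈ fixed)

  ⊸₁-involutive : ∀ {A B} {s : A ⇒ A} {t : B ⇒ B} → s ∘ s ≈ id → t ∘ t ≈ id →
                  (s ⊸₁ t) ∘ (s ⊸₁ t) ≈ id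
  ⊸₁-involutive {s = s} {t} ss≈id tt≈id = Ψ⁻¹-injective (begin
    Ψ⁻¹ ((s ⊸₁ t) ∘ (s ⊸₁ t))                         ≈⟨ Ψ⁻¹-⊸₁ ⟩
    t ∘ (Ψ⁻¹ (s ⊸₁ t) ∘ (id ⊗₁ s))                    ≈⟨ refl⟩∘⟨ Ψ⁻¹∘Ψ ⟩∘⟨refl ⟩
    t ∘ ((t ∘ (eval ∘ (id ⊗₁ s))) ∘ (id ⊗₁ s))        ≈⟨ refl⟩∘⟨ assoc ⟩
    t ∘ (t ∘ ((eval ∘ (id ⊗₁ s)) ∘ (id ⊗₁ s)))        ≈⟨ Equiv.sym assoc ⟩
    (t ∘ t) ∘ ((eval ∘ (id ⊗₁ s)) ∘ (id ⊗₁ s))        ≈⟨ tt≈id ⟩∘⟨refl ⟩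
    id ∘ ((eval ∘ (id ⊗₁ s)) ∘ (id ⊗₁ s))             ≈⟨ identityˡ ⟩
    (eval ∘ (id ⊗₁ s)) ∘ (id ⊗₁ s)                    ≈⟨ assoc ⟩
    eval ∘ ((id ⊗₁ s) ∘ (id ⊗₁ s))                    ≈⟨ refl⟩∘⟨ Equiv.sym ⊗-homomorphism ⟩
    eval ∘ ((id ∘ id) ⊗₁ (s ∘ s))                     ≈⟨ refl⟩∘⟨ ⊗-resp-≈ identityˡ ss≈id ⟩
    eval ∘ (id ⊗₁ id)                                 ≈⟨ refl⟩∘⟨ ⊗-identity ⟩
    eval ∘ id                                         ≈⟨ identityʳ ⟩
    Ψ⁻¹ id                                            ∎)

module _ {o ℓ e : Level} {C : Category o ℓ e} {M : SymmetricMonoidal C} where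
  open Category C

  InvClosed : Closed M → Closed (InvSM M)
  InvClosed K = record
    { _⊸_        = λ X Y → invObj (obj X ⊸ obj Y) (λ k → s X k ⊸₁ s Y k)
                                  (λ k → ⊸₁-involutive (invol X k) (invol Y k))
    ; Ψ          = λ f → invHom (Ψ (arr f)) (λ k → Ψ-preserves-fixed (equivariant f k))
    ; Ψ⁻¹        = λ g → invHom (Ψ⁻¹ (arr g)) (λ k → Ψ⁻¹-preserves-fixed (equivariant g k))
    ; Ψ-resp-≈   = Ψ-resp-≈
    ; Ψ⁻¹-resp-≈ = Ψ⁻¹-resp-≈
    ; Ψ⁻¹∘Ψ      = Ψ⁻¹∘Ψ
    ; Ψ∘Ψ⁻¹      = Ψ∘Ψ⁻¹
    ; Ψ-natural  = Ψ-natural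
    }
    where
      open Closed K
      open ClosedLemmas K

  InvStarAutonomous : StarAutonomous M → StarAutonomous (InvSM M)
  InvStarAutonomous S = record
    { closed    = InvClosed closed
    ; ⊥         = invObj ⊥ (λ _ → id) (λ _ → identityˡ)
    ; dualizing = λ X → Inv-reflects-iso _ (dualizing (obj X))
    }
    where
      open StarAutonomous S
      open InvIsomorphisms C

mainTheorem4 : ∀ {o ℓ e : Level} (C : Category o ℓ e) (M : SymmetricMonoidal C)
    (S : StarAutonomous M) →
    Σ (StarAutonomous (InvSM M)) λ S' → HasStandardDescription S S'
mainTheorem4 C M S = InvStarAutonomous S , (λ X Y → refl , λ k → ≈-refl) , (refl , λ k → ≈-refl)
  where open Category.Equiv C renaming (refl to ≈-refl)
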